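{- Let $L$ be a finite lattice, let $\mathbf m=\{\hat0=m_0<m_1<\dots<m_r=\hat1\}$ be a chain of left-modular elements of $L$, and let $\lambda$ be the left-modular labeling with respect to $\mathbf m$. If $x\lessdot y$ in $L$ and $\lambda(x\lessdot y)=i$, then $(m_{i-1}\vee x)\wedge m_i<(m_{i-1}\vee y)\wedge m_i$.
   Context: A pair $(x,y)$ of elements of a lattice is a modular pair if $(y\vee x)\wedge z=y\vee(x\wedge z)$ for every $z\geq y$. An element $x$ is left-modular if $(x,y)$ is a modular pair for every $y\in L$. For a cover relation $y\lessdot z$ and left-modular $m$, the element $(y\vee m)\wedge z$ equals $y$ or $z$. The left-modular labeling with respect to $\mathbf m$ is the edge labeling $\lambda(y\lessdot z)=\min\{i:(y\vee m_i)\wedge z=z\}$ (equivalently $\max\{i:(y\vee m_{i-1})\wedge z=y\}$). -}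

module Defs where

open import Level using (Level; _⊔_)
open import Data.Nat using (ℕ; suc)
open import Data.Fin using (Fin; toℕ) renaming (_<_ to _<ᶠ_)
open import Data.Product using (Σ; _×_)
open import Data.Sum using (_⊎_)
open import Relation.Nullary using (¬_)
open import Relation.Binary.Lattice.Bundles using (Lattice)

module _ {c ℓ₁ ℓ₂ : Level} (L : Lattice c ℓ₁ ℓ₂) where
  open Lattice L

  IsFinite : Set (c ⊔ ℓ₁)
  IsFinite = Σ ℕ λ n → Σ (Fin n → Carrier) λ f → ∀ x → Σ (Fin n) λ k → f k ≈ x

  _<L_ : Carrier → Carrier → Set (ℓ₁ ⊔ ℓ₂)
  x <L y = (x ≤ y) × ¬ (x ≈ y)

  _⋖_ : Carrier → Carrier → Set (c ⊔ ℓ₁ ⊔ ℓ₂)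
  x ⋖ y = (x <L y) × (∀ z → x ≤ z → z ≤ y → (z ≈ x) ⊎ (z ≈ y))

  ModularPair : Carrier → Carrier → Set (c ⊔ ℓ₁ ⊔ ℓ₂)
  ModularPair x y = ∀ z → y ≤ z → ((y ∨ x) ∧ z) ≈ (y ∨ (x ∧ z))

  LeftModular : Carrier → Set (c ⊔ ℓ₁ ⊔ ℓ₂)
  LeftModular x = ∀ y → ModularPair x y

  -- λ(x ⋖ y) = i for the left-modular labeling w.r.t. the chain m_0 < … < m_r:
  -- i is the minimum index with (x ∨ m_i) ∧ y = y.
  LMLabel : {r : ℕ} → (Fin (suc r) → Carrier) → Carrier → Carrier → Fin (suc r) → Set (ℓ₁)
  LMLabel m x y i =
    (((x ∨ m i) ∧ y) ≈ y) × (∀ j → j <ᶠ i → ¬ (((x ∨ m j) ∧ y) ≈ y))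

-- If the two sides were equal, then by left-modularity of m_i
--   y ≤ (x ∨ m_i) ∧ (m_{i-1} ∨ y) = x ∨ (m_i ∧ (m_{i-1} ∨ y)) = x ∨ (m_i ∧ (m_{i-1} ∨ x)) ≤ x ∨ m_{i-1},
-- i.e. (x ∨ m_{i-1}) ∧ y = y, contradicting the minimality of the label i.

module Submission where

open import Defs
open import Level using (Level)
open import Data.Nat using (ℕ; suc)
open import Data.Fin using (Fin; zero; suc; inject₁; fromℕ) renaming (_<_ to _<ᶠ_)
open import Data.Fin.Properties using (≤̄⇒inject₁<; ≤-refl)
open import Data.Product using (_,_; proj₁; proj₂)
open import Relation.Nullary using (¬_)
open import Relation.Binary.Lattice.Bundles using (Lattice)
import Relation.Binary.Lattice.Properties.JoinSemilattice as JoinProperties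
import Relation.Binary.Lattice.Properties.MeetSemilattice as MeetProperties
import Relation.Binary.Reasoning.PartialOrder as ≤-Reasoning

module _ {c ℓ₁ ℓ₂ : Level} (L : Lattice c ℓ₁ ℓ₂) where
  open Lattice L
  open JoinProperties joinSemilattice using (∨-monotonic; ∨-cong; ∨-comm)
  open MeetProperties meetSemilattice using (∧-monotonic; ∧-comm; y≤x⇒x∧y≈y)

  ∨-∧-monotonicʳ : ∀ a b {x y} → x ≤ y → (a ∨ x) ∧ b ≤ (a ∨ y) ∧ b
  ∨-∧-monotonicʳ a b x≤y = ∧-monotonic (∨-monotonic refl x≤y) refl

  ∧≈ʳ⇒≤ : ∀ {w y} → w ∧ y ≈ y → y ≤ w
  ∧≈ʳ⇒≤ w∧y≈y = trans (reflexive (Eq.sym w∧y≈y)) (x∧y≤x _ _)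

  ≤-∨-if-∨-∧-equal : ∀ {a b x y} → ModularPair L b x → x ≤ y → y ≤ x ∨ b →
    (a ∨ x) ∧ b ≈ (a ∨ y) ∧ b → y ≤ x ∨ a
  ≤-∨-if-∨-∧-equal {a} {b} {x} {y} modular x≤y y≤x∨b eq = begin
    y                     ≤⟨ ∧-greatest y≤x∨b (y≤x∨y a y) ⟩
    (x ∨ b) ∧ (a ∨ y)     ≈⟨ modular (a ∨ y) (trans x≤y (y≤x∨y a y)) ⟩
    x ∨ (b ∧ (a ∨ y))     ≈⟨ ∨-cong Eq.refl (Eq.trans (∧-comm b (a ∨ y)) (Eq.sym eq)) ⟩
    x ∨ ((a ∨ x) ∧ b)     ≤⟨ ∨-least (x≤x∨y x a) (trans (x∧y≤x _ _) (reflexive (∨-comm a x))) ⟩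
    x ∨ a                 ∎
    where open ≤-Reasoning poset

  module _ {r : ℕ} {m : Fin (suc r) → Carrier} {x y : Carrier} {i : Fin (suc r)}
           (label : LMLabel L m x y i) where

    LMLabel⇒≤∨ : y ≤ x ∨ m i
    LMLabel⇒≤∨ = ∧≈ʳ⇒≤ (proj₁ label)

    LMLabel⇒≰∨ : ∀ {j} → j <ᶠ i → ¬ (y ≤ x ∨ m j)
    LMLabel⇒≰∨ j<i y≤x∨mj = proj₂ label _ j<i (y≤x⇒x∧y≈y y≤x∨mj)

lemma4p6 : {c ℓ₁ ℓ₂ : Level} (L : Lattice c ℓ₁ ℓ₂) → IsFinite L →
    (r : ℕ) (m : Fin (suc r) → Lattice.Carrier L) →
    (∀ x → Lattice._≤_ L (m zero) x) →
    (∀ x → Lattice._≤_ L x (m (fromℕ r))) →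
    (∀ (k : Fin r) → _<L_ L (m (inject₁ k)) (m (suc k))) →
    (∀ i → LeftModular L (m i)) →
    ∀ x y → _⋖_ L x y → (j : Fin r) → LMLabel L m x y (suc j) →
    _<L_ L (Lattice._∧_ L (Lattice._∨_ L (m (inject₁ j)) x) (m (suc j)))
           (Lattice._∧_ L (Lattice._∨_ L (m (inject₁ j)) y) (m (suc j)))
lemma4p6 L _ r m _ _ _ leftModular x y ((x≤y , _) , _) j label =
  ∨-∧-monotonicʳ L (m (inject₁ j)) (m (suc j)) x≤y ,
  λ eq → LMLabel⇒≰∨ L label (≤̄⇒inject₁< ≤-refl)
           (≤-∨-if-∨-∧-equal L (leftModular (suc j) x) x≤y (LMLabel⇒≤∨ L label) eq)
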